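{- Let $\Sigma=\{c_1,\ldots,c_\sigma\}$ be a totally ordered alphabet, $n\geq 1$, and $n_1,\ldots,n_\sigma\geq 0$ integers with $\sum_{i=1}^\sigma n_i=n-1$. Let $\mathcal{U}$ be the set of tries with $n$ nodes over $\Sigma$ in which exactly $n_i$ edges are labeled $c_i$ for every $i$, let $\mathcal{M}$ be the set of $\sigma\times n$ binary matrices whose $i$-th row contains exactly $n_i$ ones for every $i\in[\sigma]$, and let $f:\mathcal{U}\to\mathcal{M}$ be the map defined below. Then a matrix $M\in\mathcal{M}$ belongs to $f(\mathcal{U})$ if and only if its associated sequence $\mathcal{L}_M$ is a Łukasiewicz path.
   Context: A trie over $\Sigma$ is a finite rooted tree with edges labeled by symbols of $\Sigma$, such that outgoing edges of a node have pairwise distinct labels and siblings are ordered by their incoming labels; tries are considered up to label-preserving isomorphism. For a node $u$, $out(u)$ is the set of labels of edges outgoing from $u$. The map $f$: given $\mathcal{T}\in\mathcal{U}$, let $u_1,\ldots,u_n$ be its nodes in pre-order (children visited in label order); $f(\mathcal{T})$ is the $\sigma\times n$ binary matrix $M$ with $M[i][j]=1$ iff $c_i\in out(u_j)$. For $M\in\mathcal{M}$, define $\mathcal{D}_M[i]$ to be the number of ones in the $i$-th column of $M$ minus $1$, and $\mathcal{L}_M[i]=\sum_{j=1}^{i}\mathcal{D}_M[j]$, for $i\in[n]$. A Łukasiewicz path is a sequence $\mathcal{L}$ of $n$ integers with (i) $\mathcal{L}[n]=-1$, and for every $i\in[n-1]$: (ii) $\mathcal{L}[i]\geq 0$ and (iii)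 $\mathcal{L}[i+1]-\mathcal{L}[i]\geq -1$. -}

module Defs where

open import Data.Nat using (ℕ; zero; suc; _+_)
open import Data.Bool using (Bool; true; false; if_then_else_)
open import Data.Maybe using (Maybe; just; nothing; is-just)
open import Data.List using (List; []; _∷_; _++_; length)
open import Data.Fin using (Fin; fromℕ; inject₁)
import Data.Fin as Fin
open import Data.Vec using (Vec; []; _∷_; lookup; transpose; fromList)
import Data.Vec as Vec
open import Data.Integer using (ℤ; +_; -[1+_]; _-_; _≤_)
import Data.Integer as ℤ
open import Data.Product using (Σ; _×_)
open import Relation.Binary.PropositionalEquality using (_≡_; subst)

-- The alphabet Σ = {c_1 < ... < c_σ} is Fin σ (ordered by Fin order).
-- A trie over Fin σ, up to label-preserving isomorphism, is canonically
-- a node together with, for each label (in label order), an optional child.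
data Trie (σ : ℕ) : Set where
  node : Vec (Maybe (Trie σ)) σ → Trie σ

outCol : ∀ {σ k} → Vec (Maybe (Trie σ)) k → Vec Bool k
outCol = Vec.map is-just

mutual
  preorder : ∀ {σ} → Trie σ → List (Vec Bool σ)
  preorder (node cs) = outCol cs ∷ preorderChildren cs

  preorderChildren : ∀ {σ k} → Vec (Maybe (Trie σ)) k → List (Vec Bool σ)
  preorderChildren [] = []
  preorderChildren (nothing ∷ cs) = preorderChildren cs
  preorderChildren (just t ∷ cs) = preorder t ++ preorderChildren cs

size : ∀ {σ} → Trie σ → ℕ
size t = length (preorder t)

mutual
  edgesLabeled : ∀ {σ} → Trie σ → Fin σ → ℕ
  edgesLabeled (node cs) i =
    (if is-just (lookup cs i) then 1 else 0) + edgesLabeledChildren cs i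

  edgesLabeledChildren : ∀ {σ k} → Vec (Maybe (Trie σ)) k → Fin σ → ℕ
  edgesLabeledChildren [] i = 0
  edgesLabeledChildren (nothing ∷ cs) i = edgesLabeledChildren cs i
  edgesLabeledChildren (just t ∷ cs) i = edgesLabeled t i + edgesLabeledChildren cs i

Matrix : ℕ → ℕ → Set
Matrix σ n = Vec (Vec Bool n) σ

f : ∀ {σ} (t : Trie σ) → Matrix σ (size t)
f t = transpose (fromList (preorder t))

ones : ∀ {k} → Vec Bool k → ℕ
ones [] = 0
ones (true ∷ v) = suc (ones v)
ones (false ∷ v) = ones v

InU : ∀ {σ} (n : ℕ) (ns : Vec ℕ σ) → Trie σ → Set
InU n ns t = (size t ≡ n) × (∀ (i : Fin _) → edgesLabeled t i ≡ lookup ns i)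

InM : ∀ {σ n} (ns : Vec ℕ σ) → Matrix σ n → Set
InM ns M = ∀ i → ones (lookup M i) ≡ lookup ns i

InImage : ∀ {σ} (n : ℕ) (ns : Vec ℕ σ) → Matrix σ n → Set
InImage {σ} n ns M =
  Σ (Trie σ) λ t → Σ (InU n ns t) λ u → subst (Matrix σ) (Data.Product.proj₁ u) (f t) ≡ M

𝒟 : ∀ {σ n} → Matrix σ n → Vec ℤ n
𝒟 M = Vec.map (λ col → + ones col - + 1) (transpose M)

prefixSums : ∀ {n} → Vec ℤ n → Vec ℤ n
prefixSums [] = []
prefixSums (x ∷ xs) = x ∷ Vec.map (λ y → x ℤ.+ y) (prefixSums xs)

ℒ : ∀ {σ n} → Matrix σ n → Vec ℤ n
ℒ M = prefixSums (𝒟 M)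

-- Łukasiewicz path of length suc m (positions 1..m+1 ↦ Fin indices 0..m)
IsŁukasiewicz : ∀ {m} → Vec ℤ (suc m) → Set
IsŁukasiewicz {m} L =
  (lookup L (fromℕ m) ≡ -[1+ 0 ])
  × (∀ (i : Fin m) → + 0 ≤ lookup L (inject₁ i))
  × (∀ (i : Fin m) → -[1+ 0 ] ≤ lookup L (Fin.suc i) - lookup L (inject₁ i))

-- Read the columns of M from left to right as a stack of pending subtrees, starting with
-- one (the root): the column of a node fills one pending subtree and opens one per child.
-- The stack height after column i is exactly ℒ_M[i] + 1, so "the stack never empties
-- early and is empty at the end" is the Łukasiewicz condition, the step condition being
-- automatic since every 𝒟_M[i] ≥ -1. A pre-order column sequence clearly runs this
-- stack correctly, and conversely a correct run is decoded into a trie by recursive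
-- descent; the trie then has the right number of nodes and of c_i-edges, because the
-- c_i-edges are counted by the ones in row i.

module Submission where

open import Defs
open import Data.Nat using (ℕ; zero; suc; _+_; _≤_; s≤s; z≤n)
import Data.Nat.Properties as ℕₚ
open import Data.Bool using (Bool; true; false; if_then_else_)
open import Data.Maybe using (Maybe; just; nothing; is-just)
open import Data.List using (List; []; _∷_; _++_; length)
import Data.List.Properties as Listₚ
open import Data.Fin using (Fin)
import Data.Fin as Fin
open import Data.Vec using (Vec; []; _∷_; [_]; lookup; transpose; fromList; toList; replicate; _⊛_; map; sum)
import Data.Vec.Properties as Vecₚ
open import Data.Vec.Relation.Binary.Pointwise.Extensional using (ext; Pointwise-≡⇒≡)
open import Data.Integer using (ℤ; +_; -[1+_]; _-_; -≤+; -≤-; +≤+)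
  renaming (_+_ to _+ℤ_; _≤_ to _≤ℤ_)
import Data.Integer.Properties as ℤₚ
open import Algebra.Properties.AbelianGroup ℤₚ.+-0-abelianGroup using (xyx⁻¹≈y)
open import Data.Product using (Σ; ∃; _×_; _,_; proj₁; proj₂)
open import Data.Unit using (⊤; tt)
open import Data.Empty using (⊥)
open import Function.Base using (_∘_)
open import Function.Bundles using (_⇔_; mk⇔; Equivalence)
open import Function.Construct.Symmetry using (⇔-sym)
open import Function.Related.Propositional using (module EquationalReasoning)
open import Relation.Binary.PropositionalEquality
  using (_≡_; refl; sym; trans; cong; cong₂; cong-app; subst; module ≡-Reasoning)

lookup-transpose : ∀ {A : Set} {m n} (M : Vec (Vec A n) m) (j : Fin n) →
                   lookup (transpose M) j ≡ map (λ row → lookup row j) M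
lookup-transpose                 []         j = Vecₚ.lookup-replicate j []
lookup-transpose {A} {suc m} {n} (as ∷ ass) j = begin
  lookup (replicate n cons ⊛ as ⊛ transpose ass) j
    ≡⟨ Vecₚ.lookup-⊛ j (replicate n cons ⊛ as) (transpose ass) ⟩
  lookup (replicate n cons ⊛ as) j (lookup (transpose ass) j)
    ≡⟨ cong-app (Vecₚ.lookup-⊛ j (replicate n cons) as) _ ⟩
  lookup (replicate n cons) j (lookup as j) (lookup (transpose ass) j)
    ≡⟨ cong (λ g → g (lookup as j) (lookup (transpose ass) j)) (Vecₚ.lookup-replicate j cons) ⟩
  lookup as j ∷ lookup (transpose ass) j
    ≡⟨ cong (lookup as j ∷_) (lookup-transpose ass j) ⟩
  lookup as j ∷ map (λ row → lookup row j) ass ∎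
  where
  open ≡-Reasoning
  cons : A → Vec A m → Vec A (suc m)
  cons = _∷_

transpose-involutive : ∀ {A : Set} {m n} (M : Vec (Vec A n) m) → transpose (transpose M) ≡ M
transpose-involutive M = Pointwise-≡⇒≡ (ext λ i → Pointwise-≡⇒≡ (ext λ j → begin
  lookup (lookup (transpose (transpose M)) i) j
    ≡⟨ cong (λ row → lookup row j) (lookup-transpose (transpose M) i) ⟩
  lookup (map (λ col → lookup col i) (transpose M)) j
    ≡⟨ Vecₚ.lookup-map j _ (transpose M) ⟩
  lookup (lookup (transpose M) j) i
    ≡⟨ cong (λ col → lookup col i) (lookup-transpose M j) ⟩
  lookup (map (λ row → lookup row j) M) i
    ≡⟨ Vecₚ.lookup-map i _ M ⟩
  lookup (lookup M i) j ∎))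
  where open ≡-Reasoning

transpose-≡⇔ : ∀ {A : Set} {m n} {M : Vec (Vec A n) m} {N : Vec (Vec A m) n} →
               transpose M ≡ N ⇔ M ≡ transpose N
transpose-≡⇔ {M = M} {N} = mk⇔
  (λ eq → trans (sym (transpose-involutive M)) (cong transpose eq))
  (λ eq → trans (cong transpose eq) (transpose-involutive N))

subst-transpose : ∀ {A : Set} {σ m n} (e : m ≡ n) (cols : Vec (Vec A σ) m) →
                  subst (λ k → Vec (Vec A k) σ) e (transpose cols) ≡
                  transpose (subst (Vec (Vec A σ)) e cols)
subst-transpose refl cols = refl

module _ {A : Set} where

  toList-subst : ∀ {m n} (e : m ≡ n) (xs : Vec A m) → toList (subst (Vec A) e xs) ≡ toList xs
  toList-subst refl xs = refl

  subst-fromList : ∀ {n} {xs : List A} {ys : Vec A n} (e : length xs ≡ n) →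
                   xs ≡ toList ys → subst (Vec A) e (fromList xs) ≡ ys
  subst-fromList {ys = ys} e refl = trans (Vecₚ.subst-is-cast e _) (Vecₚ.fromList∘toList ys)

  subst-fromList⇔ : ∀ {n} (xs : List A) (ys : Vec A n) (e : length xs ≡ n) →
                    subst (Vec A) e (fromList xs) ≡ ys ⇔ xs ≡ toList ys
  subst-fromList⇔ xs ys e = mk⇔
    (λ eq → trans (sym (Vecₚ.toList∘fromList xs))
                  (trans (sym (toList-subst e (fromList xs))) (cong toList eq)))
    (subst-fromList e)

f-≡⇔ : ∀ {σ n} (t : Trie σ) (e : size t ≡ n) (M : Matrix σ n) →
       subst (Matrix σ) e (f t) ≡ M ⇔ preorder t ≡ toList (transpose M)
f-≡⇔ {σ} t e M = begin
  subst (Matrix σ) e (f t) ≡ M                     ≡⟨ cong (_≡ M) (subst-transpose e cols) ⟩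
  transpose (subst (Vec (Vec Bool σ)) e cols) ≡ M  ∼⟨ transpose-≡⇔ ⟩
  subst (Vec (Vec Bool σ)) e cols ≡ transpose M    ∼⟨ subst-fromList⇔ (preorder t) (transpose M) e ⟩
  preorder t ≡ toList (transpose M)                ∎
  where
  open EquationalReasoning
  cols = fromList (preorder t)

-- cols is the pre-order column sequence of a list of k tries: each column fills one
-- pending subtree and opens one per child.
ForestCode : ∀ {σ} → ℕ → List (Vec Bool σ) → Set
ForestCode zero    []           = ⊤
ForestCode zero    (_ ∷ _)      = ⊥
ForestCode (suc k) []           = ⊥
ForestCode (suc k) (col ∷ cols) = ForestCode (ones col + k) cols

mutual
  forestCode-preorder : ∀ {σ k} (t : Trie σ) {rest : List (Vec Bool σ)} →
                        ForestCode k rest → ForestCode (suc k) (preorder t ++ rest)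
  forestCode-preorder (node cs) = forestCode-preorderChildren cs

  forestCode-preorderChildren : ∀ {σ j k} (cs : Vec (Maybe (Trie σ)) j) {rest : List (Vec Bool σ)} →
                                ForestCode k rest →
                                ForestCode (ones (outCol cs) + k) (preorderChildren cs ++ rest)
  forestCode-preorderChildren []             code = code
  forestCode-preorderChildren (nothing ∷ cs) code = forestCode-preorderChildren cs code
  forestCode-preorderChildren (just t ∷ cs) {rest} code =
    subst (ForestCode (suc (ones (outCol cs) + _)))
          (sym (Listₚ.++-assoc (preorder t) (preorderChildren cs) rest))
          (forestCode-preorder t (forestCode-preorderChildren cs code))

mutual
  decodeTrie : ∀ {σ k} (fuel : ℕ) (cols : List (Vec Bool σ)) → length cols ≤ fuel →
               ForestCode (suc k) cols →
               Σ (Trie σ) λ t → Σ (List (Vec Bool σ)) λ rest →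
                 preorder t ++ rest ≡ cols × ForestCode k rest
  decodeTrie fuel       []           _           ()
  decodeTrie (suc fuel) (col ∷ cols) (s≤s bound) code =
    let cs , rest , cs-out , cs-cols , rest-code = decodeChildren fuel col cols bound code
    in  node cs , rest , cong₂ _∷_ cs-out cs-cols , rest-code

  decodeChildren : ∀ {σ j k} (fuel : ℕ) (bs : Vec Bool j) (cols : List (Vec Bool σ)) →
                   length cols ≤ fuel → ForestCode (ones bs + k) cols →
                   Σ (Vec (Maybe (Trie σ)) j) λ cs → Σ (List (Vec Bool σ)) λ rest →
                     outCol cs ≡ bs × preorderChildren cs ++ rest ≡ cols × ForestCode k rest
  decodeChildren fuel []           cols bound code = [] , cols , refl , refl , code
  decodeChildren fuel (false ∷ bs) cols bound code =
    let cs , rest , cs-out , cs-cols , rest-code = decodeChildren fuel bs cols bound code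
    in  nothing ∷ cs , rest , cong (false ∷_) cs-out , cs-cols , rest-code
  decodeChildren fuel (true ∷ bs)  cols bound code =
    let t , cols′ , t-cols , cols′-code = decodeTrie fuel cols bound code
        cols′-bound = ℕₚ.≤-trans (subst (λ zs → length cols′ ≤ length zs) t-cols
                                         (Listₚ.length-++-≤ʳ cols′ {preorder t}))
                                  bound
        cs , rest , cs-out , cs-cols , rest-code = decodeChildren fuel bs cols′ cols′-bound cols′-code
    in  just t ∷ cs , rest , cong (true ∷_) cs-out ,
        trans (Listₚ.++-assoc (preorder t) (preorderChildren cs) rest)
              (trans (cong (preorder t ++_) cs-cols) t-cols) ,
        rest-code

preorder⇔forestCode : ∀ {σ} (cols : List (Vec Bool σ)) →
                      (∃ λ (t : Trie σ) → preorder t ≡ cols) ⇔ ForestCode 1 cols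
preorder⇔forestCode cols = mk⇔ encode decode
  where
  encode : (∃ λ t → preorder t ≡ cols) → ForestCode 1 cols
  encode (t , refl) = subst (ForestCode 1) (Listₚ.++-identityʳ (preorder t)) (forestCode-preorder t tt)

  decode : ForestCode 1 cols → ∃ λ t → preorder t ≡ cols
  decode code with decodeTrie (length cols) cols ℕₚ.≤-refl code
  ... | t , []    , t-cols , _  = t , trans (sym (Listₚ.++-identityʳ (preorder t))) t-cols
  ... | _ , _ ∷ _ , _      , ()

onesAt : ∀ {σ} → Fin σ → List (Vec Bool σ) → ℕ
onesAt i []           = 0
onesAt i (col ∷ cols) = (if lookup col i then 1 else 0) + onesAt i cols

onesAt-++ : ∀ {σ} (i : Fin σ) (xs ys : List (Vec Bool σ)) →
            onesAt i (xs ++ ys) ≡ onesAt i xs + onesAt i ys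
onesAt-++ i []       ys = refl
onesAt-++ i (x ∷ xs) ys = trans (cong (λ n → (if lookup x i then 1 else 0) + n) (onesAt-++ i xs ys))
                                (sym (ℕₚ.+-assoc _ (onesAt i xs) (onesAt i ys)))

mutual
  edgesLabeled≡onesAt : ∀ {σ} (t : Trie σ) (i : Fin σ) → edgesLabeled t i ≡ onesAt i (preorder t)
  edgesLabeled≡onesAt (node cs) i =
    cong₂ _+_ (cong (λ b → if b then 1 else 0) (sym (Vecₚ.lookup-map i is-just cs)))
              (edgesLabeledChildren≡onesAt cs i)

  edgesLabeledChildren≡onesAt : ∀ {σ j} (cs : Vec (Maybe (Trie σ)) j) (i : Fin σ) →
                                edgesLabeledChildren cs i ≡ onesAt i (preorderChildren cs)
  edgesLabeledChildren≡onesAt []             i = refl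
  edgesLabeledChildren≡onesAt (nothing ∷ cs) i = edgesLabeledChildren≡onesAt cs i
  edgesLabeledChildren≡onesAt (just t ∷ cs)  i = begin
    edgesLabeled t i + edgesLabeledChildren cs i
      ≡⟨ cong₂ _+_ (edgesLabeled≡onesAt t i) (edgesLabeledChildren≡onesAt cs i) ⟩
    onesAt i (preorder t) + onesAt i (preorderChildren cs)
      ≡⟨ sym (onesAt-++ i (preorder t) (preorderChildren cs)) ⟩
    onesAt i (preorder t ++ preorderChildren cs) ∎
    where open ≡-Reasoning

ones-map-lookup : ∀ {σ n} (i : Fin σ) (cols : Vec (Vec Bool σ) n) →
                  ones (map (λ col → lookup col i) cols) ≡ onesAt i (toList cols)
ones-map-lookup i []           = refl
ones-map-lookup i (col ∷ cols) with lookup col i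
... | true  = cong suc (ones-map-lookup i cols)
... | false = ones-map-lookup i cols

ones-row≡onesAt : ∀ {σ n} (M : Matrix σ n) (i : Fin σ) → ones (lookup M i) ≡ onesAt i (toList (transpose M))
ones-row≡onesAt M i = begin
  ones (lookup M i)                                        ≡⟨ cong (λ N → ones (lookup N i)) (sym (transpose-involutive M)) ⟩
  ones (lookup (transpose (transpose M)) i)                ≡⟨ cong ones (lookup-transpose (transpose M) i) ⟩
  ones (map (λ col → lookup col i) (transpose M))          ≡⟨ ones-map-lookup i (transpose M) ⟩
  onesAt i (toList (transpose M))                          ∎
  where open ≡-Reasoning

inImage⇔preorder : ∀ {σ n} {ns : Vec ℕ σ} (M : Matrix σ n) → InM ns M →
                   InImage n ns M ⇔ (∃ λ (t : Trie σ) → preorder t ≡ toList (transpose M))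
inImage⇔preorder {ns = ns} M M∈ℳ = mk⇔
  (λ { (t , (e , _) , ft≡M) → t , Equivalence.to (f-≡⇔ t e M) ft≡M })
  (λ { (t , t-cols) →
     let e = trans (cong length t-cols) (Vecₚ.length-toList (transpose M))
     in  t , (e , edgeCounts t t-cols) , Equivalence.from (f-≡⇔ t e M) t-cols })
  where
  edgeCounts : ∀ t → preorder t ≡ toList (transpose M) → ∀ i → edgesLabeled t i ≡ lookup ns i
  edgeCounts t t-cols i = begin
    edgesLabeled t i                 ≡⟨ edgesLabeled≡onesAt t i ⟩
    onesAt i (preorder t)            ≡⟨ cong (onesAt i) t-cols ⟩
    onesAt i (toList (transpose M))  ≡⟨ sym (ones-row≡onesAt M i) ⟩
    ones (lookup M i)                ≡⟨ M∈ℳ i ⟩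
    lookup ns i                      ∎
    where open ≡-Reasoning

prefixSumsFrom : ∀ {n} → ℤ → Vec ℤ n → Vec ℤ n
prefixSumsFrom b []       = []
prefixSumsFrom b (x ∷ xs) = b +ℤ x ∷ prefixSumsFrom (b +ℤ x) xs

map-+-prefixSums : ∀ {n} (b : ℤ) (xs : Vec ℤ n) → map (b +ℤ_) (prefixSums xs) ≡ prefixSumsFrom b xs
map-+-prefixSums b []       = refl
map-+-prefixSums b (x ∷ xs) = cong (b +ℤ x ∷_) (begin
  map (b +ℤ_) (map (x +ℤ_) (prefixSums xs))  ≡⟨ Vecₚ.map-∘ (b +ℤ_) (x +ℤ_) (prefixSums xs) ⟨
  map (λ y → b +ℤ (x +ℤ y)) (prefixSums xs)   ≡⟨ Vecₚ.map-cong (λ y → ℤₚ.+-assoc b x y) (prefixSums xs) ⟨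
  map ((b +ℤ x) +ℤ_) (prefixSums xs)          ≡⟨ map-+-prefixSums (b +ℤ x) xs ⟩
  prefixSumsFrom (b +ℤ x) xs                   ∎)
  where open ≡-Reasoning

prefixSums≡prefixSumsFrom0 : ∀ {n} (xs : Vec ℤ n) → prefixSums xs ≡ prefixSumsFrom (+ 0) xs
prefixSums≡prefixSumsFrom0 xs = begin
  prefixSums xs                ≡⟨ Vecₚ.map-id (prefixSums xs) ⟨
  map (λ y → y) (prefixSums xs) ≡⟨ Vecₚ.map-cong ℤₚ.+-identityˡ (prefixSums xs) ⟨
  map (+ 0 +ℤ_) (prefixSums xs) ≡⟨ map-+-prefixSums (+ 0) xs ⟩
  prefixSumsFrom (+ 0) xs      ∎
  where open ≡-Reasoning

IsŁukasiewicz-[_] : ∀ x → IsŁukasiewicz [ x ] ⇔ x ≡ -[1+ 0 ]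
IsŁukasiewicz-[ x ] = mk⇔ proj₁ (λ x≡-1 → x≡-1 , (λ ()) , (λ ()))

IsŁukasiewicz-∷ : ∀ {m} x y (L : Vec ℤ m) → -[1+ 0 ] ≤ℤ y - x →
                  IsŁukasiewicz (x ∷ y ∷ L) ⇔ (+ 0 ≤ℤ x × IsŁukasiewicz (y ∷ L))
IsŁukasiewicz-∷ x y L step = mk⇔
  (λ (last , nonneg , steps) → nonneg Fin.zero , last , nonneg ∘ Fin.suc , steps ∘ Fin.suc)
  (λ (0≤x , last , nonneg , steps) →
     last , (λ { Fin.zero → 0≤x  ; (Fin.suc i) → nonneg i })
          , (λ { Fin.zero → step ; (Fin.suc i) → steps i }))

IsŁukasiewicz-prefixSumsFrom-∷ : ∀ {m} b y z (zs : Vec ℤ m) → -[1+ 0 ] ≤ℤ z →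
  IsŁukasiewicz (prefixSumsFrom b (y ∷ z ∷ zs)) ⇔
  (+ 0 ≤ℤ b +ℤ y × IsŁukasiewicz (prefixSumsFrom (b +ℤ y) (z ∷ zs)))
IsŁukasiewicz-prefixSumsFrom-∷ b y z zs z≥-1 =
  IsŁukasiewicz-∷ _ _ _ (subst (-[1+ 0 ] ≤ℤ_) (sym (xyx⁻¹≈y (b +ℤ y) z)) z≥-1)

columnStep : ∀ {σ} → Vec Bool σ → ℤ
columnStep col = + ones col - + 1

columnStep-≥ : ∀ {σ} (col : Vec Bool σ) → -[1+ 0 ] ≤ℤ columnStep col
columnStep-≥ col with ones col
... | zero  = -≤- z≤n
... | suc _ = -≤+

+-columnStep : ∀ {σ} (c : ℕ) (col : Vec Bool σ) → + c +ℤ columnStep col ≡ + (ones col + c) - + 1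
+-columnStep c col = trans (sym (ℤₚ.+-assoc (+ c) (+ ones col) -[1+ 0 ]))
  (cong (_+ℤ -[1+ 0 ]) (trans (sym (ℤₚ.pos-+ c (ones col))) (cong +_ (ℕₚ.+-comm c (ones col)))))

-- ones col + c is the stack height after reading col, one more than the path value there.
lukasiewicz⇔forestCode : ∀ {σ m} (c : ℕ) (cols : Vec (Vec Bool σ) (suc m)) →
  IsŁukasiewicz (prefixSumsFrom (+ c) (map columnStep cols)) ⇔ ForestCode (suc c) (toList cols)
lukasiewicz⇔forestCode c (col ∷ []) with ones col + c | +-columnStep c col
... | zero  | x≡-1 = mk⇔ (λ _ → tt) (λ _ → Equivalence.from IsŁukasiewicz-[ _ ] x≡-1)
... | suc s | x≡s  = mk⇔ (λ (x≡-1 , _) → s≢-1 (trans (sym x≡s) x≡-1)) (λ ())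
  where
  s≢-1 : + s ≡ -[1+ 0 ] → ⊥
  s≢-1 ()
lukasiewicz⇔forestCode c (col ∷ col′ ∷ cols) with ones col + c | +-columnStep c col
... | zero  | x≡-1 = mk⇔ (λ isŁ → 0≰-1 (subst (+ 0 ≤ℤ_) x≡-1 (proj₁ (Equivalence.to headStep isŁ)))) (λ ())
  where
  headStep = IsŁukasiewicz-prefixSumsFrom-∷ (+ c) (columnStep col) _ (map columnStep cols) (columnStep-≥ col′)
  0≰-1 : + 0 ≤ℤ -[1+ 0 ] → ⊥
  0≰-1 ()
... | suc s | x≡s  = begin
  IsŁukasiewicz (prefixSumsFrom (+ c) (map columnStep (col ∷ col′ ∷ cols)))
    ∼⟨ IsŁukasiewicz-prefixSumsFrom-∷ (+ c) (columnStep col) _ (map columnStep cols) (columnStep-≥ col′) ⟩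
  (+ 0 ≤ℤ x × IsŁukasiewicz (prefixSumsFrom x rest))
    ≡⟨ cong (λ b → + 0 ≤ℤ b × IsŁukasiewicz (prefixSumsFrom b rest)) x≡s ⟩
  (+ 0 ≤ℤ + s × IsŁukasiewicz (prefixSumsFrom (+ s) rest))
    ∼⟨ mk⇔ proj₂ (+≤+ z≤n ,_) ⟩
  IsŁukasiewicz (prefixSumsFrom (+ s) rest)
    ∼⟨ lukasiewicz⇔forestCode s (col′ ∷ cols) ⟩
  ForestCode (suc s) (toList (col′ ∷ cols)) ∎
  where
  open EquationalReasoning
  x = + c +ℤ columnStep col
  rest = map columnStep (col′ ∷ cols)

lemma6 : (σ m : ℕ) (ns : Vec ℕ σ) → sum ns ≡ m →
    (M : Matrix σ (suc m)) → InM ns M →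
    InImage (suc m) ns M ⇔ IsŁukasiewicz (ℒ M)
lemma6 σ m ns _ M M∈ℳ = begin
  InImage (suc m) ns M
    ∼⟨ inImage⇔preorder {ns = ns} M M∈ℳ ⟩
  (∃ λ t → preorder t ≡ toList (transpose M))
    ∼⟨ preorder⇔forestCode (toList (transpose M)) ⟩
  ForestCode 1 (toList (transpose M))
    ∼⟨ ⇔-sym (lukasiewicz⇔forestCode 0 (transpose M)) ⟩
  IsŁukasiewicz (prefixSumsFrom (+ 0) (𝒟 M))
    ≡⟨ cong IsŁukasiewicz (prefixSums≡prefixSumsFrom0 (𝒟 M)) ⟨
  IsŁukasiewicz (ℒ M) ∎
  where open EquationalReasoning
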